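{- For each $n\geq 2$, there exist sets $D_n\subseteq\mathbb{Q}^n$ which are topologically dense in $\mathbb{Q}^n$ and such that no two distinct points of $D_n$ are colinear.
   Context: $\mathbb{Q}^n$ carries the usual product topology. Two points of $\mathbb{Q}^n$ are colinear if they share a common coordinate, i.e. $a_i=b_i$ for some $i\leq n$. -}

module Defs where

open import Level using (0ℓ)
open import Data.Nat using (ℕ)
open import Data.Fin using (Fin)
open import Data.Vec using (Vec; lookup)
open import Data.Rational using (ℚ; _<_)
open import Data.Product using (Σ; ∃; _×_)
open import Relation.Binary.PropositionalEquality using (_≡_)
open import Relation.Unary using (Pred)

Point : ℕ → Set
Point n = Vec ℚ n

Colinear : {n : ℕ} → Point n → Point n → Set
Colinear {n} a b = ∃ λ (i : Fin n) → lookup a i ≡ lookup b i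

InBox : {n : ℕ} → Point n → Point n → Point n → Set
InBox {n} l u x = (i : Fin n) → (lookup l i < lookup x i) × (lookup x i < lookup u i)

-- D is dense in ℚ^n (product topology): every nonempty basic open box
-- ∏ᵢ (lᵢ , uᵢ) with lᵢ < uᵢ contains a point of D.
Dense : {n : ℕ} → Pred (Point n) 0ℓ → Set
Dense {n} D = (l u : Point n) → ((i : Fin n) → lookup l i < lookup u i) →
  Σ (Point n) λ d → D d × InBox l u d

module Submission where

-- A point of D is indexed by a vector of dyadic intervals [aᵢ/2^eᵢ, (aᵢ+1)/2^eᵢ]. Let E be an
-- injective code of the whole vector, larger than every eᵢ; the i-th coordinate is
-- aᵢ/2^eᵢ + 1/2^E. It lies in the i-th interval, so D meets every box, and its reduced
-- denominator is exactly 2^E. So one shared coordinate of two points of D determines E,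
-- hence the index vector, hence the point.

open import Defs
open import Level using (0ℓ)
open import Data.Nat as ℕ using (ℕ; _≤_; zero; suc; _^_; _∸_; pred)
import Data.Nat.Properties as ℕ
open import Data.Nat.Divisibility using (_∣_; ∣-trans; ∣1⇒≡1; ∣m+n∣m⇒∣n; ∣m⇒∣m*n)
open import Data.Nat.Coprimality as Coprimality using (Coprime; coprime-divisor; 1-coprimeTo)
open import Data.Integer as ℤ using (ℤ; +_; -[1+_]; 1ℤ; ∣_∣)
import Data.Integer.Properties as ℤ
open import Data.Integer.DivMod using (_/ℕ_; n<s[n/ℕd]*d; [n/ℕd]*d≤n)
open import Data.Integer.Tactic.RingSolver using (solve-∀)
open import Data.Rational as ℚ using (ℚ; mkℚ; *<*; ↥_; ↧_)
open import Data.Fin using (zero; suc)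
open import Data.Vec using (Vec; []; _∷_; map; lookup; tabulate)
open import Data.Vec.Properties using (lookup-map; lookup∘tabulate)
open import Data.Product using (Σ; ∃; _×_; _,_; proj₁; proj₂)
open import Data.Empty using (⊥; ⊥-elim)
open import Function using (_∘_)
open import Relation.Unary using (Pred)
open import Relation.Binary.Definitions using (tri<; tri≈; tri>)
open import Relation.Binary.PropositionalEquality

pair : ℕ → ℕ → ℕ
pair zero    n = suc (2 ℕ.* n)
pair (suc m) n = 2 ℕ.* pair m n

pair>0 : ∀ m n → 0 ℕ.< pair m n
pair>0 zero    n = ℕ.s≤s ℕ.z≤n
pair>0 (suc m) n = ℕ.≤-trans (pair>0 m n) (ℕ.m≤m+n (pair m n) _)

m<pair[m,n] : ∀ m n → m ℕ.< pair m n
m<pair[m,n] zero    n = pair>0 zero n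
m<pair[m,n] (suc m) n = ℕ.+-mono-<-≤ (pair>0 m n) (ℕ.≤-trans (m<pair[m,n] m n) (ℕ.m≤m+n (pair m n) 0))

n<pair[m,n] : ∀ m n → n ℕ.< pair m n
n<pair[m,n] zero    n = ℕ.s≤s (ℕ.m≤m+n n (n ℕ.+ 0))
n<pair[m,n] (suc m) n = ℕ.≤-trans (n<pair[m,n] m n) (ℕ.m≤m+n (pair m n) _)

2*-injective : ∀ m n → 2 ℕ.* m ≡ 2 ℕ.* n → m ≡ n
2*-injective m n = ℕ.*-cancelˡ-≡ m n 2

pair-injective : ∀ m n m′ n′ → pair m n ≡ pair m′ n′ → m ≡ m′ × n ≡ n′
pair-injective zero    n zero     n′ eq = refl , 2*-injective n n′ (ℕ.suc-injective eq)
pair-injective zero    n (suc m′) n′ eq = ⊥-elim (ℕ.even≢odd (pair m′ n′) n (sym eq))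
pair-injective (suc m) n zero     n′ eq = ⊥-elim (ℕ.even≢odd (pair m n) n′ eq)
pair-injective (suc m) n (suc m′) n′ eq with pair-injective m n m′ n′ (2*-injective _ _ eq)
... | refl , n≡n′ = refl , n≡n′

interleave : ℤ → ℕ
interleave (+ n)    = 2 ℕ.* n
interleave -[1+ n ] = suc (2 ℕ.* n)

interleave-injective : ∀ i j → interleave i ≡ interleave j → i ≡ j
interleave-injective (+ m)    (+ n)    eq = cong +_ (2*-injective m n eq)
interleave-injective (+ m)    -[1+ n ] eq = ⊥-elim (ℕ.even≢odd m n eq)
interleave-injective -[1+ m ] (+ n)    eq = ⊥-elim (ℕ.even≢odd n m (sym eq))
interleave-injective -[1+ m ] -[1+ n ] eq = cong -[1+_] (2*-injective m n (ℕ.suc-injective eq))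

code : ∀ {n} → Vec (ℕ × ℤ) n → ℕ
code []             = 0
code ((e , a) ∷ ws) = pair e (pair (interleave a) (code ws))

code-injective : ∀ {n} (vs ws : Vec (ℕ × ℤ) n) → code vs ≡ code ws → vs ≡ ws
code-injective [] [] _ = refl
code-injective ((e , a) ∷ vs) ((e′ , a′) ∷ ws) eq
  with pair-injective e _ e′ _ eq
... | refl , eq′ with pair-injective (interleave a) _ (interleave a′) _ eq′
... | a≡a′ , eq″ with interleave-injective a a′ a≡a′ | code-injective vs ws eq″
... | refl | refl = refl

proj₁-lookup<code : ∀ {n} (ws : Vec (ℕ × ℤ) n) i → proj₁ (lookup ws i) ℕ.< code ws
proj₁-lookup<code ((e , a) ∷ ws) zero    = m<pair[m,n] e _
proj₁-lookup<code ((e , a) ∷ ws) (suc i) =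
  ℕ.<-trans (proj₁-lookup<code ws i)
    (ℕ.<-trans (n<pair[m,n] (interleave a) (code ws)) (n<pair[m,n] e _))

coprime-* : ∀ {m a b} → Coprime m a → Coprime m b → Coprime m (a ℕ.* b)
coprime-* m⊥a m⊥b (d∣m , d∣ab) =
  m⊥b (d∣m , coprime-divisor (λ (c∣d , c∣a) → m⊥a (∣-trans c∣d d∣m , c∣a)) d∣ab)

coprime-^ : ∀ {m a} → Coprime m a → ∀ e → Coprime m (a ^ e)
coprime-^ {m} m⊥a zero    = Coprimality.sym (1-coprimeTo m)
coprime-^     m⊥a (suc e) = coprime-* m⊥a (coprime-^ m⊥a e)

odd-coprime-2 : ∀ t → Coprime (suc (2 ℕ.* t)) 2
odd-coprime-2 t {d} (d∣odd , d∣2) =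
  ∣1⇒≡1 (∣m+n∣m⇒∣n (subst (d ∣_) (ℕ.+-comm 1 (2 ℕ.* t)) d∣odd) (∣m⇒∣m*n t d∣2))

∣1+2k∣-odd : ∀ k → ∃ λ t → ∣ 1ℤ ℤ.+ + 2 ℤ.* k ∣ ≡ suc (2 ℕ.* t)
∣1+2k∣-odd (+ n)    = n , cong (λ j → ∣ 1ℤ ℤ.+ j ∣) (sym (ℤ.pos-* 2 n))
∣1+2k∣-odd -[1+ n ] = n , cong ∣_∣ (begin
  1ℤ ℤ.+ + 2 ℤ.* -[1+ n ]        ≡⟨ negate (+ n) ⟩
  ℤ.- (1ℤ ℤ.+ + 2 ℤ.* + n)       ≡⟨ cong (λ j → ℤ.- (1ℤ ℤ.+ j)) (sym (ℤ.pos-* 2 n)) ⟩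
  -[1+ 2 ℕ.* n ]                 ∎)
  where
  open ≡-Reasoning
  negate : ∀ j → 1ℤ ℤ.+ + 2 ℤ.* (ℤ.- (1ℤ ℤ.+ j)) ≡ ℤ.- (1ℤ ℤ.+ + 2 ℤ.* j)
  negate = solve-∀

suc-pred[2^e] : ∀ e → suc (pred (2 ^ e)) ≡ 2 ^ e
suc-pred[2^e] e = ℕ.suc-pred (2 ^ e) {{ℕ.m^n≢0 2 e}}

oddOver : ℕ → ℤ → ℚ
oddOver e k = mkℚ (1ℤ ℤ.+ + 2 ℤ.* k) (pred (2 ^ e)) odd⊥2^e
  where
  odd⊥2^e : Coprime ∣ 1ℤ ℤ.+ + 2 ℤ.* k ∣ (suc (pred (2 ^ e)))
  odd⊥2^e with ∣1+2k∣-odd k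
  ... | t , eq = subst₂ Coprime (sym eq) (sym (suc-pred[2^e] e)) (coprime-^ (odd-coprime-2 t) e)

2^-injective : ∀ {m n} → 2 ^ m ≡ 2 ^ n → m ≡ n
2^-injective {m} {n} eq with ℕ.<-cmp m n
... | tri< m<n _ _ = ⊥-elim (ℕ.<-irrefl eq (ℕ.^-monoʳ-< 2 (ℕ.s≤s (ℕ.s≤s ℕ.z≤n)) m<n))
... | tri≈ _ m≡n _ = m≡n
... | tri> _ _ n<m = ⊥-elim (ℕ.<-irrefl (sym eq) (ℕ.^-monoʳ-< 2 (ℕ.s≤s (ℕ.s≤s ℕ.z≤n)) n<m))

n<2^n : ∀ n → n ℕ.< 2 ^ n
n<2^n zero    = ℕ.s≤s ℕ.z≤n
n<2^n (suc n) = ℕ.+-mono-<-≤ (ℕ.m^n>0 2 n) (ℕ.≤-trans (n<2^n n) (ℕ.m≤m+n _ 0))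

-- (e , a) stands for the dyadic interval [a/2ᵉ, (a+1)/2ᵉ].
DyadicIn : ℚ → ℚ → ℕ × ℤ → Set
DyadicIn l u (e , a) = (↥ l ℤ.* + (2 ^ e) ℤ.≤ a ℤ.* ↧ l) × ((1ℤ ℤ.+ a) ℤ.* ↧ u ℤ.≤ ↥ u ℤ.* + (2 ^ e))

<⇒∃dyadicIn : ∀ {l u} → l ℚ.< u → ∃ (DyadicIn l u)
<⇒∃dyadicIn {mkℚ p q _} {mkℚ r s _} (*<* ps<rq) =
  (e , a) , ℤ.<⇒≤ pP<aQ , ℤ.*-cancelˡ-≤-pos ((1ℤ ℤ.+ a) ℤ.* S) (r ℤ.* P) Q Q[1+a]S≤QrP
  where
  open ℤ.≤-Reasoning
  Q = + suc q
  S = + suc s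
  -- a/2ᵉ is the first multiple of 1/2ᵉ above p/Q; since 2/2ᵉ ≤ 1/(QS) ≤ r/S − p/Q,
  -- the next one is still at most r/S.
  e = 2 ℕ.* suc q ℕ.* suc s
  P = + (2 ^ e)
  d = (p ℤ.* P) /ℕ suc q
  a = 1ℤ ℤ.+ d
  pP<aQ : p ℤ.* P ℤ.< a ℤ.* Q
  pP<aQ = n<s[n/ℕd]*d (p ℤ.* P) (suc q)
  2QS≤P : + 2 ℤ.* Q ℤ.* S ℤ.≤ P
  2QS≤P = subst (ℤ._≤ P) (trans (ℤ.pos-* (2 ℕ.* suc q) (suc s)) (cong (ℤ._* S) (ℤ.pos-* 2 (suc q))))
            (ℤ.+≤+ (ℕ.<⇒≤ (n<2^n e)))
  Q[1+a]S≤QrP : Q ℤ.* ((1ℤ ℤ.+ a) ℤ.* S) ℤ.≤ Q ℤ.* (r ℤ.* P)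
  Q[1+a]S≤QrP = begin
    Q ℤ.* ((1ℤ ℤ.+ a) ℤ.* S)         ≡⟨ expand Q S d ⟩
    (d ℤ.* Q ℤ.+ + 2 ℤ.* Q) ℤ.* S    ≤⟨ ℤ.*-monoʳ-≤-nonNeg S (ℤ.+-monoˡ-≤ (+ 2 ℤ.* Q) ([n/ℕd]*d≤n (p ℤ.* P) (suc q))) ⟩
    (p ℤ.* P ℤ.+ + 2 ℤ.* Q) ℤ.* S    ≡⟨ regroup p P Q S ⟩
    p ℤ.* S ℤ.* P ℤ.+ + 2 ℤ.* Q ℤ.* S ≤⟨ ℤ.+-monoʳ-≤ (p ℤ.* S ℤ.* P) 2QS≤P ⟩
    p ℤ.* S ℤ.* P ℤ.+ P              ≡⟨ factor p P S ⟩
    (1ℤ ℤ.+ p ℤ.* S) ℤ.* P           ≤⟨ ℤ.*-monoʳ-≤-nonNeg P (ℤ.i<j⇒suc[i]≤j ps<rq) ⟩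
    r ℤ.* Q ℤ.* P                    ≡⟨ rotate r P Q ⟩
    Q ℤ.* (r ℤ.* P)                  ∎
    where
    expand : ∀ Q S d → Q ℤ.* ((1ℤ ℤ.+ (1ℤ ℤ.+ d)) ℤ.* S) ≡ (d ℤ.* Q ℤ.+ + 2 ℤ.* Q) ℤ.* S
    expand = solve-∀
    regroup : ∀ p P Q S → (p ℤ.* P ℤ.+ + 2 ℤ.* Q) ℤ.* S ≡ p ℤ.* S ℤ.* P ℤ.+ + 2 ℤ.* Q ℤ.* S
    regroup = solve-∀
    factor : ∀ p P S → p ℤ.* S ℤ.* P ℤ.+ P ≡ (1ℤ ℤ.+ p ℤ.* S) ℤ.* P
    factor = solve-∀
    rotate : ∀ r P Q → r ℤ.* Q ℤ.* P ≡ Q ℤ.* (r ℤ.* P)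
    rotate = solve-∀

oddOver-between : ∀ {l u e a} → DyadicIn l u (e , a) → ∀ m →
  let x = oddOver (suc e ℕ.+ m) (a ℤ.* + (2 ^ m)) in l ℚ.< x × x ℚ.< u
oddOver-between {mkℚ p q _} {mkℚ r s _} {e} {a} (pP≤aQ , [1+a]S≤rP) m =
  *<* (subst₂ (λ D N → p ℤ.* D ℤ.< N ℤ.* + suc q) (sym denominator) (sym numerator) below) ,
  *<* (subst₂ (λ D N → N ℤ.* + suc s ℤ.< r ℤ.* D) (sym denominator) (sym numerator) above)
  where
  open ℤ.≤-Reasoning
  P = + (2 ^ e)
  K = + (2 ^ suc m)
  numerator : 1ℤ ℤ.+ + 2 ℤ.* (a ℤ.* + (2 ^ m)) ≡ 1ℤ ℤ.+ a ℤ.* K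
  numerator = cong (ℤ._+_ 1ℤ) (trans (swap (+ 2) a (+ (2 ^ m))) (cong (a ℤ.*_) (sym (ℤ.pos-* 2 (2 ^ m)))))
    where
    swap : ∀ x y z → x ℤ.* (y ℤ.* z) ≡ y ℤ.* (x ℤ.* z)
    swap = solve-∀
  denominator : + suc (pred (2 ^ (suc e ℕ.+ m))) ≡ P ℤ.* K
  denominator = begin-equality
    + suc (pred (2 ^ (suc e ℕ.+ m)))  ≡⟨ cong +_ (suc-pred[2^e] (suc e ℕ.+ m)) ⟩
    + (2 ^ (suc e ℕ.+ m))             ≡⟨ cong (λ n → + (2 ^ n)) (ℕ.+-suc e m) ⟨
    + (2 ^ (e ℕ.+ suc m))             ≡⟨ cong +_ (ℕ.^-distribˡ-+-* 2 e (suc m)) ⟩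
    + (2 ^ e ℕ.* 2 ^ suc m)           ≡⟨ ℤ.pos-* (2 ^ e) (2 ^ suc m) ⟩
    P ℤ.* K                           ∎
  below : p ℤ.* (P ℤ.* K) ℤ.< (1ℤ ℤ.+ a ℤ.* K) ℤ.* + suc q
  below = begin-strict
    p ℤ.* (P ℤ.* K)                 ≡⟨ ℤ.*-assoc p P K ⟨
    p ℤ.* P ℤ.* K                   ≤⟨ ℤ.*-monoʳ-≤-nonNeg K pP≤aQ ⟩
    a ℤ.* + suc q ℤ.* K             ≡⟨ ℤ.+-identityʳ _ ⟨
    a ℤ.* + suc q ℤ.* K ℤ.+ + 0     <⟨ ℤ.+-monoʳ-< (a ℤ.* + suc q ℤ.* K) (ℤ.+<+ (ℕ.s≤s ℕ.z≤n)) ⟩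
    a ℤ.* + suc q ℤ.* K ℤ.+ + suc q ≡⟨ factor a (+ suc q) K ⟩
    (1ℤ ℤ.+ a ℤ.* K) ℤ.* + suc q    ∎
    where
    factor : ∀ a Q K → a ℤ.* Q ℤ.* K ℤ.+ Q ≡ (1ℤ ℤ.+ a ℤ.* K) ℤ.* Q
    factor = solve-∀
  above : (1ℤ ℤ.+ a ℤ.* K) ℤ.* + suc s ℤ.< r ℤ.* (P ℤ.* K)
  above = begin-strict
    (1ℤ ℤ.+ a ℤ.* K) ℤ.* + suc s  <⟨ ℤ.*-monoʳ-<-pos (+ suc s) (ℤ.+-monoˡ-< (a ℤ.* K) 1<K) ⟩
    (K ℤ.+ a ℤ.* K) ℤ.* + suc s   ≡⟨ factor a (+ suc s) K ⟩
    (1ℤ ℤ.+ a) ℤ.* + suc s ℤ.* K  ≤⟨ ℤ.*-monoʳ-≤-nonNeg K [1+a]S≤rP ⟩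
    r ℤ.* P ℤ.* K                 ≡⟨ ℤ.*-assoc r P K ⟩
    r ℤ.* (P ℤ.* K)               ∎
    where
    1<K : 1ℤ ℤ.< K
    1<K = ℤ.+<+ (ℕ.*-monoʳ-≤ 2 (ℕ.m^n>0 2 m))
    factor : ∀ a S K → (K ℤ.+ a ℤ.* K) ℤ.* S ≡ (1ℤ ℤ.+ a) ℤ.* S ℤ.* K
    factor = solve-∀

-- For e < E this is a/2ᵉ + 1/2ᴱ.
shifted : ℕ → ℕ × ℤ → ℚ
shifted E (e , a) = oddOver E (a ℤ.* + (2 ^ (E ∸ suc e)))

shifted-between : ∀ {l u E} w → proj₁ w ℕ.< E → DyadicIn l u w →
  l ℚ.< shifted E w × shifted E w ℚ.< u
shifted-between {l} {u} {E} (e , a) e<E w⊆[l,u] =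
  subst (λ E′ → l ℚ.< oddOver E′ k × oddOver E′ k ℚ.< u) (ℕ.m+[n∸m]≡n e<E)
    (oddOver-between {l} {u} {e} {a} w⊆[l,u] (E ∸ suc e))
  where k = a ℤ.* + (2 ^ (E ∸ suc e))

shifted-injectiveˡ : ∀ {E E′} w w′ → shifted E w ≡ shifted E′ w′ → E ≡ E′
shifted-injectiveˡ {E} {E′} w w′ eq = 2^-injective (begin
  2 ^ E                           ≡⟨ suc-pred[2^e] E ⟨
  ℚ.denominatorℕ (shifted E w)    ≡⟨ cong ℚ.denominatorℕ eq ⟩
  ℚ.denominatorℕ (shifted E′ w′)  ≡⟨ suc-pred[2^e] E′ ⟩
  2 ^ E′                          ∎)
  where open ≡-Reasoning

point : ∀ {n} → Vec (ℕ × ℤ) n → Point n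
point ws = map (shifted (code ws)) ws

D : (n : ℕ) → Pred (Point n) 0ℓ
D n x = ∃ λ (ws : Vec (ℕ × ℤ) n) → x ≡ point ws

D-dense : ∀ n → Dense (D n)
D-dense n l u l<u = point ws , (ws , refl) , point-inBox
  where
  dyadic : ∀ i → ∃ (DyadicIn (lookup l i) (lookup u i))
  dyadic i = <⇒∃dyadicIn (l<u i)
  ws : Vec (ℕ × ℤ) n
  ws = tabulate (proj₁ ∘ dyadic)
  point-inBox : InBox l u (point ws)
  point-inBox i = subst (λ x → lookup l i ℚ.< x × x ℚ.< lookup u i) (sym (lookup-map i _ ws))
    (shifted-between (lookup ws i) (proj₁-lookup<code ws i)
      (subst (DyadicIn (lookup l i) (lookup u i)) (sym (lookup∘tabulate (proj₁ ∘ dyadic) i))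
        (proj₂ (dyadic i))))

D-noncolinear : ∀ n (x y : Point n) → D n x → D n y → x ≢ y → Colinear x y → ⊥
D-noncolinear n _ _ (vs , refl) (ws , refl) x≢y (i , xᵢ≡yᵢ) =
  x≢y (cong point (code-injective vs ws (shifted-injectiveˡ (lookup vs i) (lookup ws i) (begin
    shifted (code vs) (lookup vs i)  ≡⟨ lookup-map i _ vs ⟨
    lookup (point vs) i              ≡⟨ xᵢ≡yᵢ ⟩
    lookup (point ws) i              ≡⟨ lookup-map i _ ws ⟩
    shifted (code ws) (lookup ws i)  ∎))))
  where open ≡-Reasoning

-- The construction works in every dimension.
proposition1p4 : (n : ℕ) → 2 ≤ n →
    Σ (Pred (Point n) 0ℓ) λ D →
    Dense D × ((x y : Point n) → D x → D y → x ≢ y → (Colinear x y → ⊥))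
proposition1p4 n _ = D n , D-dense n , D-noncolinear n
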